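{- Let $\mathcal{C}$ be a class of graphs and $k\ge 0$ an integer. If $\mathcal{C}$ has a hierarchical distance-vector labelling scheme with labels of at most $k$ bits, then $\mathcal{C}$ has an isometric-universal graph with at most $2^{k+1}-1$ vertices.
   Context: Graphs are finite; $d_G(u,v)$ is the distance in $G$. A subgraph $G$ of $H$ is isometric if $d_G(u,v)=d_H(u,v)$ for all $u,v\in V(G)$; $H$ is isometric-universal for $\mathcal{C}$ if it contains an isometric copy of every $G\in\mathcal{C}$. A hierarchical decomposition of $G$ is a pair $(T,(B_t)_{t\in V(T)})$ where $T$ is a rooted tree and $(B_t)$ is a partition of $V(G)$ into non-empty sets (bags) indexed by the nodes of $T$, such that for every edge $uv\in E(G)$, the bag of $u$ is indexed by an ancestor (in $T$, where every node is its own ancestor) of the node indexing the bag of $v$, or vice versa. Given an ordering $v_1,\dots,v_n$ of $V(G)$, the $V(G)$-index of $v_j$ is $j$. A vertex $u$ is an ancestor of $v$ if either $u$'s bag is indexed by a strict ancestor of the node of $v$'s bag, or $u,v$ lie in the same bag and the index of $u$ is at most that of $v$. The natural ordering of the ancestors of $v$: if $t_1,\dots,t_k$ are the nodes on the path from the root $t_1$ of $T$ to the node $t_k$ whose bag contains $v$, list for $i=1,\dots,k$ in order the vertices of $B_{t_i}$ sorted by increasing index, where for $B_{t_k}$ only vertices of index at most that of $v$ are listed (so $v$ is last). A hierarchical distance-vector labelling scheme for $\mathcal{C}$ with labels of at most $k$ bits is a function $D$ from finite binary strings to pairs of finite sequences of natural numbers such that for every $G\in\mathcal{C}$ with $n$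 vertices there exist an ordering $v_1,\dots,v_n$ of $V(G)$, a function $\ell_G:V(G)\to\{0,1\}^*$ with $|\ell_G(v)|\le k$ for all $v$, and a hierarchical decomposition of $G$ such that for every $v\in V(G)$, $D(\ell_G(v))=(p(v),x(v))$, where $p(v)$ is the sequence of $V(G)$-indices of the ancestors of $v$ in their natural ordering, and $x(v)$ has the same length as $p(v)$ with $i$-th entry $d_G(v,v_{p(v)_i})$. -}

module Defs where

open import Data.Nat using (ℕ; zero; suc; _<_; _≤_)
open import Data.Fin as Fin using (Fin; toℕ)
open import Data.Fin.Properties using (_≟_)
open import Data.Bool using (Bool; true; false)
open import Data.List using (List; []; _∷_; _++_; concatMap; filter; length; map; allFin)
open import Data.List.Relation.Binary.Pointwise using (Pointwise)
open import Data.Product using (Σ; ∃; ∃-syntax; _×_; _,_; proj₁; proj₂)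
open import Data.Sum using (_⊎_)
open import Relation.Nullary using (¬_)
open import Relation.Nullary.Decidable using (_×-dec_)
open import Relation.Binary.PropositionalEquality using (_≡_; _≢_)
open import Function using (_∘_; Injective)
open import Function.Bundles using (_↔_; _⇔_; Inverse)

record Graph : Set where
  field
    n      : ℕ
    adj    : Fin n → Fin n → Bool
    sym    : ∀ u v → adj u v ≡ adj v u
    irrefl : ∀ u → adj u u ≡ false
open Graph public

Edge : (G : Graph) → Fin (n G) → Fin (n G) → Set
Edge G u v = adj G u v ≡ true

data Walk (G : Graph) : Fin (n G) → Fin (n G) → ℕ → Set where
  here : ∀ {u} → Walk G u u 0
  step : ∀ {u w v m} → Edge G u w → Walk G w v m → Walk G u v (suc m)

-- d_G(u,v) = d  (no such d exists iff u, v lie in different components)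
Dist : (G : Graph) → Fin (n G) → Fin (n G) → ℕ → Set
Dist G u v d = Walk G u v d × (∀ d′ → d′ < d → ¬ Walk G u v d′)

IsometricCopy : Graph → Graph → Set
IsometricCopy G H =
  Σ (Fin (n G) → Fin (n H)) λ f →
    Injective _≡_ _≡_ f
    × (∀ u v → Edge G u v → Edge H (f u) (f v))
    × (∀ u v d → Dist G u v d ⇔ Dist H (f u) (f v) d)

IsometricUniversal : (Graph → Set) → Graph → Set
IsometricUniversal 𝒞 H = ∀ G → 𝒞 G → IsometricCopy G H

record RootedTree (m : ℕ) : Set where
  field
    root       : Fin m
    parent     : Fin m → Fin m
    depth      : Fin m → ℕ
    parent-root : parent root ≡ root
    depth-root : depth root ≡ 0
    depth0     : ∀ t → depth t ≡ 0 → t ≡ root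
    depth-par  : ∀ t → t ≢ root → suc (depth (parent t)) ≡ depth t
open RootedTree public

iter : ∀ {A : Set} → (A → A) → ℕ → A → A
iter f zero    a = a
iter f (suc j) a = iter f j (f a)

-- s is an ancestor of t in T (every node is its own ancestor)
TreeAnc : ∀ {m} → RootedTree m → Fin m → Fin m → Set
TreeAnc T s t = ∃[ j ] iter (parent T) j t ≡ s

-- strict ancestors of t listed from the root downwards (first argument: depth of t)
strictPath : ∀ {m} → RootedTree m → ℕ → Fin m → List (Fin m)
strictPath T zero    t = []
strictPath T (suc j) t = strictPath T j (parent T t) ++ (parent T t ∷ [])

-- Hierarchical decompositions: tree T with bags B_t = { v | bag v ≡ t },
-- a partition of V(G) into non-empty sets.

record HierDecomp (G : Graph) : Set where
  field
    m        : ℕ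
    tree     : RootedTree m
    bag      : Fin (n G) → Fin m
    nonempty : ∀ t → ∃[ v ] bag v ≡ t
    edgeCond : ∀ u v → Edge G u v →
               TreeAnc tree (bag u) (bag v) ⊎ TreeAnc tree (bag v) (bag u)
open HierDecomp public

-- Ordering v_1,…,v_n of V(G) given as a bijection ord : Fin n ↔ V(G);
-- v_j = Inverse.to ord (j-1), and the V(G)-index of w is 1 + toℕ (from w).

Ordering : Graph → Set
Ordering G = Fin (n G) ↔ Fin (n G)

index : (G : Graph) → Ordering G → Fin (n G) → ℕ
index G σ w = suc (toℕ (Inverse.from σ w))

-- The ancestors of v in their natural ordering, given as positions
-- (0-based) in the ordering: for each strict ancestor node t_i of the
-- node of v (from the root down), the whole bag B_{t_i} by increasing
-- index; then the vertices of v's own bag of index ≤ index of v.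
ancestorPositions : (G : Graph) → Ordering G → HierDecomp G → Fin (n G) → List (Fin (n G))
ancestorPositions G σ H v =
  concatMap (λ t → filter (λ j → bag H (Inverse.to σ j) ≟ t) (allFin (n G)))
            (strictPath (tree H) (depth (tree H) (bag H v)) (bag H v))
  ++ filter (λ j → (bag H (Inverse.to σ j) ≟ bag H v) ×-dec (j Fin.≤? Inverse.from σ v))
            (allFin (n G))

HDVLabelling : (Graph → Set) → ℕ → Set
HDVLabelling 𝒞 k =
  Σ (List Bool → List ℕ × List ℕ) λ D →
    ∀ G → 𝒞 G →
      Σ (Ordering G) λ σ →
      Σ (Fin (n G) → List Bool) λ ℓ →
      Σ (HierDecomp G) λ H →
        (∀ v → length (ℓ v) ≤ k)
        × (∀ v → proj₁ (D (ℓ v)) ≡ map (λ j → suc (toℕ j)) (ancestorPositions G σ H v)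
                 × Pointwise (λ j d → Dist G v (Inverse.to σ j) d)
                             (ancestorPositions G σ H v) (proj₂ (D (ℓ v))))

module Submission where

-- The universal graph has one vertex per bit string of length at most k, i.e. 2^(k+1) − 1
-- vertices, and each vertex carries the decoded label (p, x).  Labels a and b are adjacent
-- when one is a "child" of the other: p_b is a proper prefix of p_a, the distance vectors
-- differ by at most one on that prefix, and some position carries distance 0 in b and 1 in a.
-- Since the ancestor lists of adjacent vertices of G are nested, v ↦ ℓ(v) maps edges to
-- edges, hence does not increase distances.  Conversely, along any walk of length m in the
-- universal graph the shortest ancestor list is shared by all its labels, and some position i
-- of it satisfies x_a(i) + x_b(i) ≤ m for the end labels a, b: going through the common
-- ancestor at position i gives a walk of length ≤ m in G.

open import Defs renaming (sym to adj-sym)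
open import Data.Bool using (Bool; true; false)
open import Data.Bool.Properties using (T-≡)
open import Data.Empty using (⊥-elim)
open import Data.Fin as Fin using (Fin; toℕ; fromℕ<)
open import Data.Fin.Properties using (toℕ-fromℕ<; toℕ-injective) renaming (_≟_ to _≟ᶠ_; <-cmp to <-cmpᶠ)
open import Data.List using (List; []; _∷_; _++_; length; map; filter; concatMap; allFin)
open import Data.List.Properties using (length-map; length-++; ++-assoc; filter-accept; filter-reject; filter-none; filter-≐; concatMap-++)
open import Data.List.Membership.Propositional using (_∈_)
open import Data.List.Membership.Propositional.Properties using (∈-filter⁺; ∈-filter⁻; ∈-allFin; ∈-++⁻; ∈-++⁺ʳ)
open import Data.List.Relation.Binary.Pointwise using (Pointwise; _∷_)
open import Data.List.Relation.Unary.All as All using (All; _∷_)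
open import Data.List.Relation.Unary.AllPairs using (AllPairs; []; _∷_)
open import Data.List.Relation.Unary.AllPairs.Properties using (tabulate⁺-<)
open import Data.List.Relation.Unary.Any using (here; there)
open import Data.Nat using (ℕ; zero; suc; _+_; _*_; _^_; _∸_; _⊓_; _≤_; _<_; _≟_; _≤?_; _<?_; z≤n; s≤s)
open import Data.Nat.Properties hiding (_≟_; _≤?_; _<?_)
open import Data.Nat.Solver using (module +-*-Solver)
open import Data.Product using (Σ; ∃-syntax; _×_; _,_; proj₁; proj₂)
open import Data.Sum using (_⊎_; inj₁; inj₂; swap)
open import Function using (_∘_; Injective)
open import Function.Bundles using (Inverse; Equivalence; _⇔_; mk⇔)
open import Level using (0ℓ)
open import Relation.Binary.Definitions using (tri<; tri≈; tri>)
open import Relation.Binary.PropositionalEquality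
open import Relation.Nullary using (¬_; Dec; yes; no)
open import Relation.Nullary.Decidable using (isYes; _×-dec_; _⊎-dec_; map′; toWitness; fromWitness)
open import Relation.Unary using (Pred; Decidable)

-- Out-of-range positions return the default; every use below is guarded by a bound.
lookupOr : {A : Set} → A → List A → ℕ → A
lookupOr d []       _       = d
lookupOr d (x ∷ xs) zero    = x
lookupOr d (x ∷ xs) (suc i) = lookupOr d xs i

infixl 9 _!_

_!_ : List ℕ → ℕ → ℕ
xs ! i = lookupOr 0 xs i

lookupOr-++ˡ : ∀ {A : Set} (d d′ : A) xs ys {i} → i < length xs →
               lookupOr d (xs ++ ys) i ≡ lookupOr d′ xs i
lookupOr-++ˡ d d′ (x ∷ xs) ys {zero}  _         = refl
lookupOr-++ˡ d d′ (x ∷ xs) ys {suc i} (s≤s i<n) = lookupOr-++ˡ d d′ xs ys i<n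

lookupOr-map : ∀ {A B : Set} (g : A → B) (d : A) (d′ : B) xs {i} → i < length xs →
               lookupOr d′ (map g xs) i ≡ g (lookupOr d xs i)
lookupOr-map g d d′ (x ∷ xs) {zero}  _         = refl
lookupOr-map g d d′ (x ∷ xs) {suc i} (s≤s i<n) = lookupOr-map g d d′ xs i<n

Pointwise-lookupOr : ∀ {A B : Set} {R : A → B → Set} {xs ys} (d : A) (d′ : B) →
                     Pointwise R xs ys → ∀ {i} → i < length xs → R (lookupOr d xs i) (lookupOr d′ ys i)
Pointwise-lookupOr d d′ (r ∷ _)  {zero}  _         = r
Pointwise-lookupOr d d′ (_ ∷ rs) {suc i} (s≤s i<n) = Pointwise-lookupOr d d′ rs i<n

∈⇒lookupOr : ∀ {A : Set} (d : A) {x xs} → x ∈ xs → ∃[ i ] (i < length xs × lookupOr d xs i ≡ x)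
∈⇒lookupOr d (here refl) = 0 , s≤s z≤n , refl
∈⇒lookupOr d (there x∈) with ∈⇒lookupOr d x∈
... | i , i<n , eq = suc i , s≤s i<n , eq

∈⇒0<length : ∀ {A : Set} {x : A} {xs} → x ∈ xs → 0 < length xs
∈⇒0<length (here _)  = s≤s z≤n
∈⇒0<length (there _) = s≤s z≤n

ProperPrefix : {A : Set} → List A → List A → Set
ProperPrefix xs ys = ∃[ s ] (ys ≡ xs ++ s × 0 < length s)

ProperPrefix⇒length< : ∀ {A : Set} {xs ys : List A} → ProperPrefix xs ys → length xs < length ys
ProperPrefix⇒length< {xs = xs} (s , refl , 0<s) =
  subst (length xs <_) (sym (length-++ xs)) (m<m+n (length xs) 0<s)

ProperPrefix-lookupOr : ∀ {A : Set} (d d′ : A) {xs ys} → ProperPrefix xs ys →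
                        ∀ {i} → i < length xs → lookupOr d ys i ≡ lookupOr d′ xs i
ProperPrefix-lookupOr d d′ {xs} (s , refl , _) = lookupOr-++ˡ d d′ xs s

module _ {n : ℕ} {P : Pred (Fin n) 0ℓ} (P? : Decidable P) (a : Fin n) where

  P≤a? : Decidable (λ j → P j × j Fin.≤ a)
  P≤a? j = P? j ×-dec j Fin.≤? a

  filter-upTo : List (Fin n) → List (Fin n)
  filter-upTo = filter P≤a?

  filter-upTo-prefix : ∀ {xs} → AllPairs Fin._<_ xs → ∃[ s ] (filter P? xs ≡ filter-upTo xs ++ s)
  filter-upTo-prefix {[]}     []                 = [] , refl
  filter-upTo-prefix {x ∷ xs} (x<xs ∷ sorted) with x Fin.≤? a
  ... | no x≰a = filter P? (x ∷ xs) , cong (_++ filter P? (x ∷ xs)) (sym (filter-none P≤a? all-above))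
    where
    all-above : All (λ y → ¬ (P y × y Fin.≤ a)) (x ∷ xs)
    all-above = (x≰a ∘ proj₂) ∷ All.map (λ x<y Py≤a → x≰a (≤-trans (<⇒≤ x<y) (proj₂ Py≤a))) x<xs
  ... | yes x≤a = prepend (P? x) (filter-upTo-prefix sorted)
    where
    open ≡-Reasoning
    prepend : Dec (P x) → ∃[ s ] (filter P? xs ≡ filter-upTo xs ++ s) →
              ∃[ s ] (filter P? (x ∷ xs) ≡ filter-upTo (x ∷ xs) ++ s)
    prepend (yes Px) (s , eq) = s , (begin
      filter P? (x ∷ xs)         ≡⟨ filter-accept P? Px ⟩
      x ∷ filter P? xs           ≡⟨ cong (x ∷_) eq ⟩
      x ∷ filter-upTo xs ++ s    ≡⟨ cong (_++ s) (sym (filter-accept P≤a? (Px , x≤a))) ⟩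
      filter-upTo (x ∷ xs) ++ s  ∎)
    prepend (no ¬Px) (s , eq) = s , (begin
      filter P? (x ∷ xs)         ≡⟨ filter-reject P? ¬Px ⟩
      filter P? xs               ≡⟨ eq ⟩
      filter-upTo xs ++ s        ≡⟨ cong (_++ s) (sym (filter-reject P≤a? (¬Px ∘ proj₁))) ⟩
      filter-upTo (x ∷ xs) ++ s  ∎)

allFin-sorted : ∀ n → AllPairs Fin._<_ (allFin n)
allFin-sorted n = tabulate⁺-< (λ i<j → i<j)

Within : ℕ → ℕ → ℕ → Set
Within m x y = x ≤ m + y × y ≤ m + x

Within-refl : ∀ x → Within 0 x x
Within-refl x = ≤-refl , ≤-refl

Within-sym : ∀ {m x y} → Within m x y → Within m y x
Within-sym (x≤ , y≤) = y≤ , x≤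

Within-trans : ∀ {m l x y z} → Within m x y → Within l y z → Within (m + l) x z
Within-trans {m} {l} {x} {y} {z} (x≤m+y , y≤m+x) (y≤l+z , z≤l+y) =
  ≤-trans x≤m+y (≤-trans (+-monoʳ-≤ m y≤l+z) (≤-reflexive (sym (+-assoc m l z)))) ,
  ≤-trans z≤l+y (≤-trans (+-monoʳ-≤ l y≤m+x)
    (≤-reflexive (trans (sym (+-assoc l m x)) (cong (_+ x) (+-comm l m)))))

module _ (G : Graph) where

  Edge-sym : ∀ {u v} → Edge G u v → Edge G v u
  Edge-sym {u} {v} e = trans (adj-sym G v u) e

  Edge-irrefl : ∀ {u} → ¬ Edge G u u
  Edge-irrefl {u} e with trans (sym e) (irrefl G u)
  ... | ()

  Walk-zero : ∀ {u v} → Walk G u v 0 → u ≡ v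
  Walk-zero here = refl

  Walk-++ : ∀ {u v w l m} → Walk G u v l → Walk G v w m → Walk G u w (l + m)
  Walk-++ here       w′ = w′
  Walk-++ (step e w) w′ = step e (Walk-++ w w′)

  Walk-reverse : ∀ {u v m} → Walk G u v m → Walk G v u m
  Walk-reverse here = here
  Walk-reverse {m = suc m} (step e w) =
    subst (Walk G _ _) (+-comm m 1) (Walk-++ (Walk-reverse w) (step (Edge-sym e) here))

  Dist-unique : ∀ {u v d d′} → Dist G u v d → Dist G u v d′ → d ≡ d′
  Dist-unique {d = d} {d′} (w , shortest) (w′ , shortest′) with <-cmp d d′
  ... | tri< d<d′ _ _ = ⊥-elim (shortest′ d d<d′ w)
  ... | tri≈ _ d≡d′ _ = d≡d′
  ... | tri> _ _ d′<d = ⊥-elim (shortest d′ d′<d w′)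

  Dist-self : ∀ {u d} → Dist G u u d → d ≡ 0
  Dist-self {d = zero}  _              = refl
  Dist-self {d = suc d} (_ , shortest) = ⊥-elim (shortest 0 (s≤s z≤n) here)

  Dist-zero : ∀ {u v} → Dist G u v 0 → u ≡ v
  Dist-zero (w , _) = Walk-zero w

  Dist-Edge : ∀ {u v d} → Edge G u v → Dist G u v d → d ≡ 1
  Dist-Edge {u} {v} e duv = Dist-unique duv (step e here , no-shorter)
    where
    no-shorter : ∀ d′ → d′ < 1 → ¬ Walk G u v d′
    no-shorter zero _ w with Walk-zero w
    ... | refl = Edge-irrefl e
    no-shorter (suc _) (s≤s ())

  Dist-Edge-≤ : ∀ {u v z d d′} → Edge G u v → Dist G u z d → Dist G v z d′ → d ≤ suc d′
  Dist-Edge-≤ {d = d} {d′} e (_ , shortest) (w′ , _) with suc d′ <? d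
  ... | yes d′+1<d = ⊥-elim (shortest (suc d′) d′+1<d (step e w′))
  ... | no  d′+1≮d = ≮⇒≥ d′+1≮d

  Dist-Edge-Within : ∀ {u v z d d′} → Edge G u v → Dist G u z d → Dist G v z d′ → Within 1 d d′
  Dist-Edge-Within e du dv = Dist-Edge-≤ e du dv , Dist-Edge-≤ (Edge-sym e) dv du

module _ (G H : Graph) (f : Fin (n G) → Fin (n H)) where

  Walk-map : (∀ u v → Edge G u v → Edge H (f u) (f v)) → ∀ {u v m} → Walk G u v m → Walk H (f u) (f v) m
  Walk-map f-edge here       = here
  Walk-map f-edge (step e w) = step (f-edge _ _ e) (Walk-map f-edge w)

  Dist-preserved : (∀ {u v m} → Walk G u v m → Walk H (f u) (f v) m) →
                   (∀ {u v m} → Walk H (f u) (f v) m → ∃[ l ] (l ≤ m × Walk G u v l)) →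
                   ∀ u v d → Dist G u v d ⇔ Dist H (f u) (f v) d
  Dist-preserved lift lower u v d = mk⇔ to from
    where
    to : Dist G u v d → Dist H (f u) (f v) d
    to (w , shortest) = lift w , λ d′ d′<d w′ →
      let (l , l≤d′ , wG) = lower w′ in shortest l (≤-<-trans l≤d′ d′<d) wG
    from : Dist H (f u) (f v) d → Dist G u v d
    from (w , shortest) with lower w
    ... | l , l≤d , wG with m≤n⇒m<n∨m≡n l≤d
    ...   | inj₁ l<d  = ⊥-elim (shortest l l<d (lift wG))
    ...   | inj₂ refl = wG , λ d′ d′<d w′ → shortest d′ d′<d (lift w′)

  Dist-preserved⇒Injective : (∀ u v d → Dist G u v d ⇔ Dist H (f u) (f v) d) → Injective _≡_ _≡_ f
  Dist-preserved⇒Injective preserved {u} {v} fu≡fv =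
    Dist-zero G (Equivalence.from (preserved u v 0) (subst (λ w → Dist H (f u) w 0) fu≡fv (here , λ _ ())))

bit : Bool → ℕ
bit false = 0
bit true  = 1

-- Bijective base-2 numeration: the strings of length ≤ k get the codes 0, …, 2^(k+1) − 2.
encode : List Bool → ℕ
encode []      = 0
encode (b ∷ s) = suc (bit b + (encode s + encode s))

halve : ℕ → ℕ × Bool
halve zero          = 0 , false
halve (suc zero)    = 0 , true
halve (suc (suc m)) = suc (proj₁ (halve m)) , proj₂ (halve m)

halve-bit+double : ∀ b c → halve (bit b + (c + c)) ≡ (c , b)
halve-bit+double false zero = refl
halve-bit+double true  zero = refl
halve-bit+double b (suc c)
  rewrite +-suc c c | +-suc (bit b) (suc (c + c)) | +-suc (bit b) (c + c) | halve-bit+double b c = refl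

-- The first argument bounds the length of the decoded string.
decode : ℕ → ℕ → List Bool
decode zero    _       = []
decode (suc k) zero    = []
decode (suc k) (suc m) = proj₂ (halve m) ∷ decode k (proj₁ (halve m))

decode-encode : ∀ k s → length s ≤ k → decode k (encode s) ≡ s
decode-encode zero    []      _          = refl
decode-encode (suc k) []      _          = refl
decode-encode (suc k) (b ∷ s) (s≤s s≤k)
  rewrite halve-bit+double b (encode s) | decode-encode k s s≤k = refl

encode+2≤ : ∀ s → 2 + encode s ≤ 2 ^ suc (length s)
encode+2≤ []      = ≤-refl
encode+2≤ (b ∷ s) = ≤-trans (≤-trans (+-monoʳ-≤ 3 (+-monoˡ-≤ (c + c) (bit≤1 b))) (≤-reflexive double))
                            (*-monoʳ-≤ 2 (encode+2≤ s))
  where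
  open +-*-Solver
  c : ℕ
  c = encode s
  bit≤1 : ∀ b → bit b ≤ 1
  bit≤1 false = z≤n
  bit≤1 true  = ≤-refl
  double : 3 + (1 + (c + c)) ≡ 2 * (2 + c)
  double = solve 1 (λ x → con 3 :+ (con 1 :+ (x :+ x)) := con 2 :* (con 2 :+ x)) refl c

encode< : ∀ k s → length s ≤ k → encode s < 2 ^ (k + 1) ∸ 1
encode< k s s≤k = subst (encode s <_) (pred[m∸n]≡m∸[1+n] (2 ^ (k + 1)) 0) (suc[m]≤n⇒m≤pred[n] encode+2≤2^[k+1])
  where
  encode+2≤2^[k+1] : 2 + encode s ≤ 2 ^ (k + 1)
  encode+2≤2^[k+1] = ≤-trans (encode+2≤ s) (≤-trans (^-monoʳ-≤ 2 (s≤s s≤k)) (≤-reflexive (cong (2 ^_) (+-comm 1 k))))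

Label : Set
Label = List ℕ × List ℕ

pos dist : Label → List ℕ
pos  = proj₁
dist = proj₂

-- a is the label of a neighbour of b's vertex lying below it in the decomposition; the hinge is
-- the position of b's vertex itself, at distance 0 from b and 1 from a.
record ChildOf (a b : Label) : Set where
  field
    longer  : length (pos b) < length (pos a)
    extends : ∀ {i} → i < length (pos b) → pos a ! i ≡ pos b ! i
    close   : ∀ {i} → i < length (pos b) → Within 1 (dist a ! i) (dist b ! i)
    hinge   : ∃[ i ] (i < length (pos b) × dist b ! i ≡ 0 × dist a ! i ≡ 1)

childOf? : ∀ a b → Dec (ChildOf a b)
childOf? a b = map′
  (λ (l , e , c , h) → record { longer = l ; extends = e ; close = c ; hinge = h })
  (λ r → let open ChildOf r in longer , (λ {i} → extends {i}) , (λ {i} → close {i}) , hinge)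
  (suc (length (pos b)) ≤? length (pos a)
   ×-dec allUpTo? (λ i → pos a ! i ≟ pos b ! i) (length (pos b))
   ×-dec allUpTo? (λ i → (dist a ! i ≤? 1 + dist b ! i) ×-dec (dist b ! i ≤? 1 + dist a ! i)) (length (pos b))
   ×-dec anyUpTo? (λ i → (dist b ! i ≟ 0) ×-dec (dist a ! i ≟ 1)) (length (pos b)))

ChildOf-irrefl : ∀ a → ¬ ChildOf a a
ChildOf-irrefl a r = <-irrefl refl (ChildOf.longer r)

Adjacent : Label → Label → Set
Adjacent a b = ChildOf a b ⊎ ChildOf b a

adjacent? : ∀ a b → Dec (Adjacent a b)
adjacent? a b = childOf? a b ⊎-dec childOf? b a

adjacent?-sym : ∀ a b → isYes (adjacent? a b) ≡ isYes (adjacent? b a)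
adjacent?-sym a b with childOf? a b | childOf? b a
... | yes _ | yes _ = refl
... | yes _ | no  _ = refl
... | no  _ | yes _ = refl
... | no  _ | no  _ = refl

adjacent?-irrefl : ∀ a → isYes (adjacent? a a) ≡ false
adjacent?-irrefl a with childOf? a a
... | yes r = ⊥-elim (ChildOf-irrefl a r)
... | no  _ = refl

labelGraph : (N : ℕ) → (Fin N → Label) → Graph
labelGraph N lab = record
  { n      = N
  ; adj    = λ i j → isYes (adjacent? (lab i) (lab j))
  ; sym    = λ i j → adjacent?-sym (lab i) (lab j)
  ; irrefl = λ i → adjacent?-irrefl (lab i)
  }

module LabelGraphWalks (N : ℕ) (lab : Fin N → Label) where

  U : Graph
  U = labelGraph N lab

  P X : Fin N → List ℕ
  P = pos ∘ lab
  X = dist ∘ lab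

  len : Fin N → ℕ
  len = length ∘ P

  Edge⇒Adjacent : ∀ {a c} → Edge U a c → Adjacent (lab a) (lab c)
  Edge⇒Adjacent e = toWitness (Equivalence.from T-≡ e)

  Adjacent⇒Edge : ∀ {a c} → Adjacent (lab a) (lab c) → Edge U a c
  Adjacent⇒Edge adj = Equivalence.to T-≡ (fromWitness adj)

  Edge-agree : ∀ {a c i} → Edge U a c → i < len a → i < len c →
               P a ! i ≡ P c ! i × Within 1 (X a ! i) (X c ! i)
  Edge-agree {i = i} e i<a i<c with Edge⇒Adjacent e
  ... | inj₁ r = ChildOf.extends r i<c , ChildOf.close r i<c
  ... | inj₂ r = sym (ChildOf.extends r i<a) , Within-sym (ChildOf.close r i<a)

  minLength : ∀ {a b m} → Walk U a b m → ℕ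
  minLength {a} here       = len a
  minLength {a} (step e w) = len a ⊓ minLength w

  minLength≤start : ∀ {a b m} (w : Walk U a b m) → minLength w ≤ len a
  minLength≤start here           = ≤-refl
  minLength≤start {a} (step e w) = m⊓n≤m (len a) (minLength w)

  minLength≤end : ∀ {a b m} (w : Walk U a b m) → minLength w ≤ len b
  minLength≤end here           = ≤-refl
  minLength≤end {a} (step e w) = ≤-trans (m⊓n≤n (len a) (minLength w)) (minLength≤end w)

  Walk-agree : ∀ {a b m i} (w : Walk U a b m) → i < minLength w →
               P a ! i ≡ P b ! i × Within m (X a ! i) (X b ! i)
  Walk-agree {i = i} here _ = refl , Within-refl _
  Walk-agree {a} (step e w) i<min =
    let i<a = <-≤-trans i<min (m⊓n≤m (len a) (minLength w))
        i<w = <-≤-trans i<min (m⊓n≤n (len a) (minLength w))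
        (Pa≡Pc , Xa~Xc) = Edge-agree e i<a (<-≤-trans i<w (minLength≤start w))
        (Pc≡Pb , Xc~Xb) = Walk-agree w i<w
    in trans Pa≡Pc Pc≡Pb , Within-trans Xa~Xc Xc~Xb

  -- If the first label is strictly shorter than the rest of the walk, the edge leaving it is
  -- a child edge and its hinge works; otherwise the position found for the tail works.
  Walk-meet : ∀ {a b m} (w : Walk U a b (suc m)) →
              ∃[ i ] (i < minLength w × P a ! i ≡ P b ! i × X a ! i + X b ! i ≤ suc m)
  Walk-meet (step e here) with Edge⇒Adjacent e
  ... | inj₁ r = let (i , i<b , Xb≡0 , Xa≡1) = ChildOf.hinge r in
    i , ⊓-glb (<-trans i<b (ChildOf.longer r)) i<b , ChildOf.extends r i<b ,
    ≤-reflexive (cong₂ _+_ Xa≡1 Xb≡0)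
  ... | inj₂ r = let (i , i<a , Xa≡0 , Xb≡1) = ChildOf.hinge r in
    i , ⊓-glb i<a (<-trans i<a (ChildOf.longer r)) , sym (ChildOf.extends r i<a) ,
    ≤-reflexive (cong₂ _+_ Xa≡0 Xb≡1)
  Walk-meet {a} {b} {suc m} (step e w@(step _ _)) with minLength w ≤? len a
  ... | yes min≤a =
    let (i , i<min , Pc≡Pb , sum≤) = Walk-meet w
        (Pa≡Pc , Xa≤ , _) = Edge-agree e (<-≤-trans i<min min≤a) (<-≤-trans i<min (minLength≤start w))
    in i , subst (i <_) (sym (m≥n⇒m⊓n≡n min≤a)) i<min , trans Pa≡Pc Pc≡Pb ,
       ≤-trans (+-monoˡ-≤ (X b ! i) Xa≤) (s≤s sum≤)
  ... | no min≰a with Edge⇒Adjacent e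
  ...   | inj₁ r = ⊥-elim (min≰a (≤-trans (minLength≤start w) (<⇒≤ (ChildOf.longer r))))
  ...   | inj₂ r =
    let (i , i<a , Xa≡0 , _) = ChildOf.hinge r
        min≡a = m≤n⇒m⊓n≡m (<⇒≤ (≰⇒> min≰a))
        (Pa≡Pb , _ , Xb≤) = Walk-agree (step e w) (subst (i <_) (sym min≡a) i<a)
    in i , subst (i <_) (sym min≡a) i<a , Pa≡Pb ,
       subst (λ x → x + X b ! i ≤ suc (suc m)) (sym Xa≡0)
         (≤-trans Xb≤ (≤-reflexive (trans (cong (suc (suc m) +_) Xa≡0) (+-identityʳ _))))

module _ {m : ℕ} (T : RootedTree m) where

  ancestorsOf : Fin m → List (Fin m)
  ancestorsOf t = strictPath T (depth T t) t

  ancestorsOf-parent : ∀ {t} → t ≢ root T → ancestorsOf t ≡ ancestorsOf (parent T t) ++ parent T t ∷ []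
  ancestorsOf-parent {t} t≢root = cong (λ d → strictPath T d t) (sym (depth-par T t t≢root))

  ancestorsOf-strict : ∀ j {s t} → iter (parent T) j t ≡ s → s ≢ t →
                       ∃[ rest ] (ancestorsOf t ≡ ancestorsOf s ++ s ∷ rest)
  ancestorsOf-strict zero    t≡s s≢t = ⊥-elim (s≢t (sym t≡s))
  ancestorsOf-strict (suc j) {s} {t} iter≡s s≢t with t ≟ᶠ root T
  ... | yes refl = ancestorsOf-strict j (trans (cong (iter (parent T) j) (sym (parent-root T))) iter≡s) s≢t
  ... | no t≢root with s ≟ᶠ parent T t
  ...   | yes refl = [] , ancestorsOf-parent t≢root
  ...   | no s≢par with ancestorsOf-strict j iter≡s s≢par
  ...     | rest , eq = rest ++ parent T t ∷ [] , (begin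
    ancestorsOf t                                        ≡⟨ ancestorsOf-parent t≢root ⟩
    ancestorsOf (parent T t) ++ parent T t ∷ []          ≡⟨ cong (_++ parent T t ∷ []) eq ⟩
    (ancestorsOf s ++ s ∷ rest) ++ parent T t ∷ []       ≡⟨ ++-assoc (ancestorsOf s) (s ∷ rest) _ ⟩
    ancestorsOf s ++ s ∷ rest ++ parent T t ∷ []         ∎)
    where open ≡-Reasoning

module AncestorLists (G : Graph) (σ : Ordering G) (H : HierDecomp G) where

  open Inverse σ using (to; from; strictlyInverseˡ)

  inBag? : (t : Fin (m H)) → Decidable (λ j → bag H (to j) ≡ t)
  inBag? t j = bag H (to j) ≟ᶠ t

  members : Fin (m H) → List (Fin (n G))
  members t = filter (inBag? t) (allFin (n G))

  membersUpTo : Fin (m H) → Fin (n G) → List (Fin (n G))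
  membersUpTo t a = filter-upTo (inBag? t) a (allFin (n G))

  A : Fin (n G) → List (Fin (n G))
  A = ancestorPositions G σ H

  above : Fin (m H) → List (Fin (n G))
  above t = concatMap members (ancestorsOf (tree H) t)

  from∈membersUpTo : ∀ v → from v ∈ membersUpTo (bag H v) (from v)
  from∈membersUpTo v = ∈-filter⁺ _ (∈-allFin (from v)) (cong (bag H) (strictlyInverseˡ v) , ≤-refl)

  from∈A : ∀ v → from v ∈ A v
  from∈A v = ∈-++⁺ʳ (above (bag H v)) (from∈membersUpTo v)

  members-prefix : ∀ t a → ∃[ s ] (members t ≡ membersUpTo t a ++ s)
  members-prefix t a = filter-upTo-prefix (inBag? t) a (allFin-sorted (n G))

  membersUpTo-prefix : ∀ {t a b} → a Fin.< b → bag H (to b) ≡ t →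
                       ProperPrefix (membersUpTo t a) (membersUpTo t b)
  membersUpTo-prefix {t} {a} {b} a<b b∈t
    with filter-upTo-prefix (P≤a? (inBag? t) b) a (allFin-sorted (n G))
  ... | s , eq = s , trans eq (cong (_++ s) narrow) , ∈⇒0<length b∈s
    where
    narrow : filter-upTo (P≤a? (inBag? t) b) a (allFin (n G)) ≡ membersUpTo t a
    narrow = filter-≐ (P≤a? (P≤a? (inBag? t) b) a) (P≤a? (inBag? t) a)
      ((λ ((j∈t , _) , j≤a) → j∈t , j≤a) , (λ (j∈t , j≤a) → (j∈t , ≤-trans j≤a (<⇒≤ a<b)) , j≤a))
      (allFin (n G))
    b∈s : b ∈ s
    b∈s with ∈-++⁻ _ (subst (b ∈_) eq (∈-filter⁺ (P≤a? (inBag? t) b) (∈-allFin b) (b∈t , ≤-refl)))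
    ... | inj₁ b∈prefix = ⊥-elim (<⇒≱ a<b (proj₂ (proj₂ (∈-filter⁻ (P≤a? (P≤a? (inBag? t) b) a) {xs = allFin (n G)} b∈prefix))))
    ... | inj₂ b∈s = b∈s

  A-sameBag : ∀ {u v} → bag H u ≡ bag H v → from u Fin.< from v → ProperPrefix (A u) (A v)
  A-sameBag {u} {v} bu≡bv fu<fv
    with membersUpTo-prefix fu<fv (trans (cong (bag H) (strictlyInverseˡ v)) (sym bu≡bv))
  ... | s , eq , 0<s = s , (begin
    above (bag H v) ++ membersUpTo (bag H v) (from v)
      ≡⟨ cong (λ t → above t ++ membersUpTo t (from v)) (sym bu≡bv) ⟩
    above (bag H u) ++ membersUpTo (bag H u) (from v)
      ≡⟨ cong (above (bag H u) ++_) eq ⟩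
    above (bag H u) ++ membersUpTo (bag H u) (from u) ++ s
      ≡⟨ sym (++-assoc (above (bag H u)) _ s) ⟩
    A u ++ s ∎) , 0<s
    where open ≡-Reasoning

  A-strict : ∀ {u v} j → iter (parent (tree H)) j (bag H v) ≡ bag H u → bag H u ≢ bag H v →
             ProperPrefix (A u) (A v)
  A-strict {u} {v} j iter≡bu bu≢bv
    with ancestorsOf-strict (tree H) j iter≡bu bu≢bv | members-prefix (bag H u) (from u)
  ... | rest , anc-eq | s , mem-eq = s ++ R ++ Xv , (begin
    above (bag H v) ++ Xv
      ≡⟨ cong (λ ts → concatMap members ts ++ Xv) anc-eq ⟩
    concatMap members (ancestorsOf (tree H) (bag H u) ++ bag H u ∷ rest) ++ Xv
      ≡⟨ cong (_++ Xv) (concatMap-++ members (ancestorsOf (tree H) (bag H u)) (bag H u ∷ rest)) ⟩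
    (C ++ members (bag H u) ++ R) ++ Xv
      ≡⟨ cong (λ ms → (C ++ ms ++ R) ++ Xv) mem-eq ⟩
    (C ++ (Xu ++ s) ++ R) ++ Xv
      ≡⟨ ++-assoc C ((Xu ++ s) ++ R) Xv ⟩
    C ++ ((Xu ++ s) ++ R) ++ Xv
      ≡⟨ cong (C ++_) (++-assoc (Xu ++ s) R Xv) ⟩
    C ++ (Xu ++ s) ++ R ++ Xv
      ≡⟨ cong (C ++_) (++-assoc Xu s (R ++ Xv)) ⟩
    C ++ Xu ++ s ++ R ++ Xv
      ≡⟨ sym (++-assoc C Xu (s ++ R ++ Xv)) ⟩
    A u ++ s ++ R ++ Xv ∎) , ∈⇒0<length (∈-++⁺ʳ s (∈-++⁺ʳ R (from∈membersUpTo v)))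
    where
    open ≡-Reasoning
    C Xu R Xv : List (Fin (n G))
    C  = above (bag H u)
    Xu = membersUpTo (bag H u) (from u)
    R  = concatMap members rest
    Xv = membersUpTo (bag H v) (from v)

  A-TreeAnc : ∀ {u v} → Edge G u v → TreeAnc (tree H) (bag H u) (bag H v) →
              ProperPrefix (A u) (A v) ⊎ ProperPrefix (A v) (A u)
  A-TreeAnc {u} {v} e (j , iter≡bu) with bag H u ≟ᶠ bag H v
  ... | no bu≢bv = inj₁ (A-strict j iter≡bu bu≢bv)
  ... | yes bu≡bv with <-cmpᶠ (from u) (from v)
  ...   | tri< fu<fv _ _ = inj₁ (A-sameBag bu≡bv fu<fv)
  ...   | tri> _ _ fv<fu = inj₂ (A-sameBag (sym bu≡bv) fv<fu)
  ...   | tri≈ _ fu≡fv _ = ⊥-elim (Edge-irrefl G (subst (Edge G u) (sym u≡v) e))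
    where
    u≡v : u ≡ v
    u≡v = trans (sym (strictlyInverseˡ u)) (trans (cong to fu≡fv) (strictlyInverseˡ v))

  A-nested : ∀ {u v} → Edge G u v → ProperPrefix (A u) (A v) ⊎ ProperPrefix (A v) (A u)
  A-nested {u} {v} e with edgeCond H u v e
  ... | inj₁ anc = A-TreeAnc e anc
  ... | inj₂ anc = swap (A-TreeAnc (Edge-sym G e) anc)

universalLabel : (k : ℕ) → (List Bool → Label) → Fin (2 ^ (k + 1) ∸ 1) → Label
universalLabel k D = D ∘ decode k ∘ toℕ

universalGraph : ℕ → (List Bool → Label) → Graph
universalGraph k D = labelGraph (2 ^ (k + 1) ∸ 1) (universalLabel k D)

module Embedding (k : ℕ) (D : List Bool → Label) (G : Graph) (σ : Ordering G)
                 (ℓ : Fin (n G) → List Bool) (H : HierDecomp G)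
                 (ℓ-short : ∀ v → length (ℓ v) ≤ k)
                 (ℓ-correct : ∀ v → pos (D (ℓ v)) ≡ map (λ j → suc (toℕ j)) (ancestorPositions G σ H v)
                                  × Pointwise (λ j d → Dist G v (Inverse.to σ j) d)
                                              (ancestorPositions G σ H v) (dist (D (ℓ v))))
  where

  open Inverse σ using (to; from; strictlyInverseˡ)
  open AncestorLists G σ H
  open LabelGraphWalks (2 ^ (k + 1) ∸ 1) (universalLabel k D)

  embed : Fin (n G) → Fin (n U)
  embed v = fromℕ< (encode< k (ℓ v) (ℓ-short v))

  label-embed : ∀ v → universalLabel k D (embed v) ≡ D (ℓ v)
  label-embed v = cong D (trans (cong (decode k) (toℕ-fromℕ< _)) (decode-encode k (ℓ v) (ℓ-short v)))

  p x : Fin (n G) → List ℕ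
  p v = pos (D (ℓ v))
  x v = dist (D (ℓ v))

  length-p : ∀ v → length (p v) ≡ length (A v)
  length-p v = trans (cong length (proj₁ (ℓ-correct v))) (length-map _ (A v))

  in-A : ∀ {v i} → i < length (p v) → i < length (A v)
  in-A {v} = subst (_ <_) (length-p v)

  ancestorPos : Fin (n G) → ℕ → Fin (n G)
  ancestorPos v i = lookupOr (from v) (A v) i

  p-! : ∀ {v i} → i < length (p v) → p v ! i ≡ suc (toℕ (ancestorPos v i))
  p-! {v} i<v = trans (cong (_! _) (proj₁ (ℓ-correct v))) (lookupOr-map (suc ∘ toℕ) (from v) 0 (A v) (in-A i<v))

  Dist-ancestor : ∀ {v i} → i < length (p v) → Dist G v (to (ancestorPos v i)) (x v ! i)
  Dist-ancestor {v} i<v = Pointwise-lookupOr (from v) 0 (proj₂ (ℓ-correct v)) (in-A i<v)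

  ancestorPos-cong : ∀ {u v i} → i < length (p u) → i < length (p v) → p u ! i ≡ p v ! i →
                     ancestorPos u i ≡ ancestorPos v i
  ancestorPos-cong i<u i<v pu≡pv = toℕ-injective (suc-injective (trans (sym (p-! i<u)) (trans pu≡pv (p-! i<v))))

  self-ancestor : ∀ v → ∃[ i ] (i < length (p v) × to (ancestorPos v i) ≡ v)
  self-ancestor v with ∈⇒lookupOr (from v) (from∈A v)
  ... | i , i<v , at-v = i , subst (i <_) (sym (length-p v)) i<v , trans (cong to at-v) (strictlyInverseˡ v)

  self-distance : ∀ {v i} → i < length (p v) → to (ancestorPos v i) ≡ v → x v ! i ≡ 0
  self-distance {v} {i} i<v at-v = Dist-self G (subst (λ w → Dist G v w (x v ! i)) at-v (Dist-ancestor i<v))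

  Edge⇒ChildOf : ∀ {u v} → Edge G u v → ProperPrefix (A u) (A v) → ChildOf (D (ℓ v)) (D (ℓ u))
  Edge⇒ChildOf {u} {v} e Au⊏Av = record
    { longer  = subst₂ _<_ (sym (length-p u)) (sym (length-p v)) (ProperPrefix⇒length< Au⊏Av)
    ; extends = λ i<u → trans (p-! (in-v i<u)) (trans (cong (suc ∘ toℕ) (same i<u)) (sym (p-! i<u)))
    ; close   = λ i<u → Dist-Edge-Within G (Edge-sym G e) (Dist-v i<u) (Dist-ancestor i<u)
    ; hinge   = let (i , i<u , at-u) = self-ancestor u in
        i , i<u , self-distance i<u at-u
                , Dist-Edge G (Edge-sym G e) (subst (λ w → Dist G v w (x v ! i)) at-u (Dist-v i<u))
    }
    where
    in-v : ∀ {i} → i < length (p u) → i < length (p v)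
    in-v i<u = <-trans i<u (subst₂ _<_ (sym (length-p u)) (sym (length-p v)) (ProperPrefix⇒length< Au⊏Av))
    same : ∀ {i} → i < length (p u) → ancestorPos v i ≡ ancestorPos u i
    same i<u = ProperPrefix-lookupOr (from v) (from u) Au⊏Av (in-A i<u)
    Dist-v : ∀ {i} → i < length (p u) → Dist G v (to (ancestorPos u i)) (x v ! i)
    Dist-v i<u = subst (λ w → Dist G v (to w) _) (same i<u) (Dist-ancestor (in-v i<u))

  embed-Edge : ∀ u v → Edge G u v → Edge U (embed u) (embed v)
  embed-Edge u v e = Adjacent⇒Edge (subst₂ Adjacent (sym (label-embed u)) (sym (label-embed v)) adjacent)
    where
    adjacent : Adjacent (D (ℓ u)) (D (ℓ v))
    adjacent with A-nested e
    ... | inj₁ Au⊏Av = inj₂ (Edge⇒ChildOf e Au⊏Av)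
    ... | inj₂ Av⊏Au = inj₁ (Edge⇒ChildOf (Edge-sym G e) Av⊏Au)

  common-position : ∀ {u v m} → Walk U (embed u) (embed v) m →
    ∃[ i ] (i < length (p u) × i < length (p v) × p u ! i ≡ p v ! i × x u ! i + x v ! i ≤ m)
  common-position {u} {v} {zero} w =
    let (i , i<u , at-u) = self-ancestor u
        xu≡0 = self-distance i<u at-u
    in i , i<u , subst (λ l → i < length (pos l)) same-label i<u , cong (λ l → pos l ! i) same-label ,
       ≤-reflexive (cong₂ _+_ xu≡0 (trans (cong (λ l → dist l ! i) (sym same-label)) xu≡0))
    where
    same-label : D (ℓ u) ≡ D (ℓ v)
    same-label = trans (sym (label-embed u)) (trans (cong (universalLabel k D) (Walk-zero U w)) (label-embed v))
  common-position {u} {v} {suc m} w with Walk-meet w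
  ... | i , i<min , P≡ , sum≤ =
    i , subst (λ l → i < length (pos l)) (label-embed u) (<-≤-trans i<min (minLength≤start w))
      , subst (λ l → i < length (pos l)) (label-embed v) (<-≤-trans i<min (minLength≤end w))
      , subst₂ (λ a b → pos a ! i ≡ pos b ! i) (label-embed u) (label-embed v) P≡
      , subst₂ (λ a b → dist a ! i + dist b ! i ≤ suc m) (label-embed u) (label-embed v) sum≤

  walk-via-ancestor : ∀ {u v i} → i < length (p u) → i < length (p v) → p u ! i ≡ p v ! i →
                      Walk G u v (x u ! i + x v ! i)
  walk-via-ancestor {u} {v} i<u i<v pu≡pv =
    Walk-++ G (proj₁ (Dist-ancestor i<u))
      (Walk-reverse G (subst (λ j → Walk G v (to j) _) (sym (ancestorPos-cong i<u i<v pu≡pv))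
                             (proj₁ (Dist-ancestor i<v))))

  embed-lower : ∀ {u v m} → Walk U (embed u) (embed v) m → ∃[ l ] (l ≤ m × Walk G u v l)
  embed-lower w =
    let (i , i<u , i<v , pu≡pv , sum≤) = common-position w in _ , sum≤ , walk-via-ancestor i<u i<v pu≡pv

  embed-Dist : ∀ u v d → Dist G u v d ⇔ Dist U (embed u) (embed v) d
  embed-Dist = Dist-preserved G U embed (Walk-map G U embed embed-Edge) embed-lower

  isometricCopy : IsometricCopy G U
  isometricCopy = embed , Dist-preserved⇒Injective G U embed embed-Dist , embed-Edge , embed-Dist

lemma3p1 : (𝒞 : Graph → Set) (k : ℕ) → HDVLabelling 𝒞 k →
    Σ Graph λ U → (n U ≤ 2 ^ (k + 1) ∸ 1) × IsometricUniversal 𝒞 U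
lemma3p1 𝒞 k (D , labelling) = universalGraph k D , ≤-refl , λ G G∈𝒞 →
  let (σ , ℓ , H , ℓ-short , ℓ-correct) = labelling G G∈𝒞
  in Embedding.isometricCopy k D G σ ℓ H ℓ-short ℓ-correct
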